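{- Let $G=(X,Y,E)$ be a finite bipartite graph with $Y$ nonempty, with non-negative weights $\omega_e$ on its edges $e\in E$ and positive integer weights $s_x$ on its vertices $x\in X$ such that $\sum_{x\in X}s_x\geq|E|$. Suppose that for all $x\in X$ and $y\in Y$, $$\sum_{e\in\delta_G(x)}\omega_e>\frac{s_x-1}{|Y|}\qquad\text{and}\qquad\sum_{e\in\delta_G(y)}\omega_e=\frac{1}{|Y|}.$$ Then every vertex $x\in X$ has degree exactly $s_x$ in $G$.
   Context: $\delta_G(z)$ denotes the set of edges of $G$ incident to the vertex $z$.
   Formalization: The edge weights $\omega_e$ are rational. -}

module Defs where

open import Data.Nat using (ℕ; zero; suc)
import Data.Nat as ℕ
open import Data.Bool using (Bool; true; false; if_then_else_)
open import Data.Fin using (Fin; zero; suc)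
open import Data.Rational using (ℚ; 0ℚ; _+_)

∑ℚ : (n : ℕ) → (Fin n → ℚ) → ℚ
∑ℚ zero    f = 0ℚ
∑ℚ (suc n) f = f zero + ∑ℚ n (λ i → f (suc i))

∑ℕ : (n : ℕ) → (Fin n → ℕ) → ℕ
∑ℕ zero    f = 0
∑ℕ (suc n) f = f zero ℕ.+ ∑ℕ n (λ i → f (suc i))

-- A finite simple bipartite graph with parts X = Fin m, Y = Fin n,
-- given by its bipartite adjacency relation: x ~ y iff adj x y ≡ true.
BipGraph : ℕ → ℕ → Set
BipGraph m n = Fin m → Fin n → Bool

numEdges : ∀ {m n} → BipGraph m n → ℕ
numEdges {m} {n} G = ∑ℕ m (λ x → ∑ℕ n (λ y → if G x y then 1 else 0))

degX : ∀ {m n} → BipGraph m n → Fin m → ℕ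
degX {m} {n} G x = ∑ℕ n (λ y → if G x y then 1 else 0)

-- Edge weights ω : an edge is a pair (x , y) with G x y ≡ true.
Weights : ℕ → ℕ → Set
Weights m n = Fin m → Fin n → ℚ

wdegX : ∀ {m n} → BipGraph m n → Weights m n → Fin m → ℚ
wdegX {m} {n} G ω x = ∑ℚ n (λ y → if G x y then ω x y else 0ℚ)

wdegY : ∀ {m n} → BipGraph m n → Weights m n → Fin n → ℚ
wdegY {m} {n} G ω y = ∑ℚ m (λ x → if G x y then ω x y else 0ℚ)

-- Every weight is at most 1/|Y|, being one non-negative term of a column sum equal to 1/|Y|, so the
-- weighted degree of x is at most deg x / |Y|. Together with (s_x - 1)/|Y| < wdeg x this forces
-- s_x ≤ deg x for every x, and then ∑ s_x ≤ ∑ deg x = |E| ≤ ∑ s_x leaves no room for a strict inequality.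
module Submission where

open import Defs
open import Data.Nat using (ℕ; suc; _≥_; _≤_)
open import Data.Fin using (Fin)
open import Data.Integer using (+_; _-_)
open import Data.Rational using (ℚ; 0ℚ; _/_; _<_) renaming (_≤_ to _≤ℚ_)
open import Relation.Binary.PropositionalEquality using (_≡_)
open import Data.Bool using (true)

open import Data.Nat as ℕ using (zero; z≤n; s≤s)
import Data.Nat.Properties as ℕ
open import Data.Fin using (zero; suc)
open import Data.Bool using (false; if_then_else_)
import Data.Integer as ℤ
import Data.Integer.Properties as ℤ
open import Data.Integer.Solver using (module +-*-Solver)
open import Data.Rational using (_+_; toℚᵘ)
import Data.Rational.Properties as ℚ
import Data.Rational.Unnormalised as ℚᵘ
import Data.Rational.Unnormalised.Properties as ℚᵘ
open import Relation.Binary.PropositionalEquality using (refl; sym; cong; subst; module ≡-Reasoning)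

toℚᵘ-/ : ∀ i k → toℚᵘ (i / suc k) ℚᵘ.≃ ℚᵘ.mkℚᵘ i k
toℚᵘ-/ i k = ℚ.toℚᵘ-fromℚᵘ (ℚᵘ.mkℚᵘ i k)

/-distribʳ-+ : ∀ i j k → (i ℤ.+ j) / suc k ≡ i / suc k + j / suc k
/-distribʳ-+ i j k = ℚ.toℚᵘ-injective (begin
  toℚᵘ ((i ℤ.+ j) / suc k)                       ≈⟨ toℚᵘ-/ (i ℤ.+ j) k ⟩
  ℚᵘ.mkℚᵘ (i ℤ.+ j) k                            ≈⟨ ℚᵘ.*≡* (solve 3 (λ i j n → (i :+ j) :* (n :* n) := (i :* n :+ j :* n) :* n) refl i j (+ suc k)) ⟩
  ℚᵘ.mkℚᵘ i k ℚᵘ.+ ℚᵘ.mkℚᵘ j k                   ≈⟨ ℚᵘ.+-cong (toℚᵘ-/ i k) (toℚᵘ-/ j k) ⟨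
  toℚᵘ (i / suc k) ℚᵘ.+ toℚᵘ (j / suc k)         ≈⟨ ℚ.toℚᵘ-homo-+ (i / suc k) (j / suc k) ⟨
  toℚᵘ (i / suc k + j / suc k)                   ∎)
  where
  open +-*-Solver
  open ℚᵘ.≃-Reasoning

/-cancelʳ-< : ∀ k {i j} → i / suc k < j / suc k → i ℤ.< j
/-cancelʳ-< k {i} {j} i/n<j/n = ℤ.*-cancelʳ-<-nonNeg (+ suc k) (ℚᵘ.drop-*<* (begin-strict
  ℚᵘ.mkℚᵘ i k         ≃⟨ toℚᵘ-/ i k ⟨
  toℚᵘ (i / suc k)    <⟨ ℚ.toℚᵘ-mono-< i/n<j/n ⟩
  toℚᵘ (j / suc k)    ≃⟨ toℚᵘ-/ j k ⟩
  ℚᵘ.mkℚᵘ j k         ∎))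
  where open ℚᵘ.≤-Reasoning

∑ℚ-nonNeg : ∀ n (f : Fin n → ℚ) → (∀ i → 0ℚ ≤ℚ f i) → 0ℚ ≤ℚ ∑ℚ n f
∑ℚ-nonNeg zero    f f≥0 = ℚ.≤-refl
∑ℚ-nonNeg (suc n) f f≥0 = ℚ.+-mono-≤ (f≥0 zero) (∑ℚ-nonNeg n (λ i → f (suc i)) (λ i → f≥0 (suc i)))

∑ℚ-mono-≤ : ∀ n {f g : Fin n → ℚ} → (∀ i → f i ≤ℚ g i) → ∑ℚ n f ≤ℚ ∑ℚ n g
∑ℚ-mono-≤ zero    f≤g = ℚ.≤-refl
∑ℚ-mono-≤ (suc n) f≤g = ℚ.+-mono-≤ (f≤g zero) (∑ℚ-mono-≤ n (λ i → f≤g (suc i)))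

term≤∑ℚ : ∀ n (f : Fin n → ℚ) → (∀ i → 0ℚ ≤ℚ f i) → ∀ i → f i ≤ℚ ∑ℚ n f
term≤∑ℚ (suc n) f f≥0 zero = begin
  f zero                         ≡⟨ ℚ.+-identityʳ (f zero) ⟨
  f zero + 0ℚ                    ≤⟨ ℚ.+-monoʳ-≤ (f zero) (∑ℚ-nonNeg n (λ i → f (suc i)) (λ i → f≥0 (suc i))) ⟩
  ∑ℚ (suc n) f                   ∎
  where open ℚ.≤-Reasoning
term≤∑ℚ (suc n) f f≥0 (suc i) = begin
  f (suc i)                      ≤⟨ term≤∑ℚ n (λ i → f (suc i)) (λ i → f≥0 (suc i)) i ⟩
  ∑ℚ n (λ i → f (suc i))         ≡⟨ ℚ.+-identityˡ _ ⟨
  0ℚ + ∑ℚ n (λ i → f (suc i))    ≤⟨ ℚ.+-monoˡ-≤ _ (f≥0 zero) ⟩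
  ∑ℚ (suc n) f                   ∎
  where open ℚ.≤-Reasoning

∑ℚ-/ : ∀ n k (f : Fin n → ℕ) → ∑ℚ n (λ i → + f i / suc k) ≡ + ∑ℕ n f / suc k
∑ℚ-/ zero    k f = sym (ℚ.0/n≡0 (suc k))
∑ℚ-/ (suc n) k f = begin
  + f zero / suc k + ∑ℚ n (λ i → + f (suc i) / suc k)   ≡⟨ cong (_+_ (+ f zero / suc k)) (∑ℚ-/ n k (λ i → f (suc i))) ⟩
  + f zero / suc k + + ∑ℕ n (λ i → f (suc i)) / suc k   ≡⟨ /-distribʳ-+ (+ f zero) (+ ∑ℕ n (λ i → f (suc i))) k ⟨
  + ∑ℕ (suc n) f / suc k                                ∎
  where open ≡-Reasoning

∑ℕ-mono-≤ : ∀ n {f g : Fin n → ℕ} → (∀ i → f i ≤ g i) → ∑ℕ n f ≤ ∑ℕ n g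
∑ℕ-mono-≤ zero    f≤g = z≤n
∑ℕ-mono-≤ (suc n) f≤g = ℕ.+-mono-≤ (f≤g zero) (∑ℕ-mono-≤ n (λ i → f≤g (suc i)))

∑ℕ≤∑ℕ⇒pointwise≡ : ∀ n {f g : Fin n → ℕ} → (∀ i → g i ≤ f i) → ∑ℕ n f ≤ ∑ℕ n g → ∀ i → f i ≡ g i
∑ℕ≤∑ℕ⇒pointwise≡ (suc n) {f} {g} g≤f ∑f≤∑g = go
  where
  ∑f′ = ∑ℕ n (λ i → f (suc i))
  ∑g′ = ∑ℕ n (λ i → g (suc i))

  ∑g′≤∑f′ : ∑g′ ≤ ∑f′
  ∑g′≤∑f′ = ∑ℕ-mono-≤ n (λ i → g≤f (suc i))

  f₀≤g₀ : f zero ≤ g zero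
  f₀≤g₀ = ℕ.+-cancelʳ-≤ ∑f′ (f zero) (g zero) (ℕ.≤-trans ∑f≤∑g (ℕ.+-monoʳ-≤ (g zero) ∑g′≤∑f′))

  ∑f′≤∑g′ : ∑f′ ≤ ∑g′
  ∑f′≤∑g′ = ℕ.+-cancelˡ-≤ (f zero) ∑f′ ∑g′ (ℕ.≤-trans ∑f≤∑g (ℕ.+-monoˡ-≤ ∑g′ (g≤f zero)))

  go : ∀ i → f i ≡ g i
  go zero    = ℕ.≤-antisym f₀≤g₀ (g≤f zero)
  go (suc i) = ∑ℕ≤∑ℕ⇒pointwise≡ n (λ i → g≤f (suc i)) ∑f′≤∑g′ i

module _ {m k} (G : BipGraph m (suc k)) (ω : Weights m (suc k))
         (ω-nonNeg : ∀ x y → G x y ≡ true → 0ℚ ≤ℚ ω x y) where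

  weight≤wdegY : ∀ {x y} → G x y ≡ true → ω x y ≤ℚ wdegY G ω y
  weight≤wdegY {x} {y} x~y = subst (λ b → (if b then ω x y else 0ℚ) ≤ℚ wdegY G ω y) x~y
    (term≤∑ℚ m (λ x′ → if G x′ y then ω x′ y else 0ℚ) masked-nonNeg x)
    where
    masked-nonNeg : ∀ x′ → 0ℚ ≤ℚ (if G x′ y then ω x′ y else 0ℚ)
    masked-nonNeg x′ with G x′ y in x′~y
    ... | true  = ω-nonNeg x′ y x′~y
    ... | false = ℚ.≤-refl

  wdegX≤degX/|Y| : (∀ y → wdegY G ω y ≤ℚ + 1 / suc k) → ∀ x → wdegX G ω x ≤ℚ + degX G x / suc k
  wdegX≤degX/|Y| wdegY≤1/|Y| x = begin
    wdegX G ω x                                                   ≤⟨ ∑ℚ-mono-≤ (suc k) masked≤indicator ⟩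
    ∑ℚ (suc k) (λ y → + (if G x y then 1 else 0) / suc k)         ≡⟨ ∑ℚ-/ (suc k) k (λ y → if G x y then 1 else 0) ⟩
    + degX G x / suc k                                            ∎
    where
    open ℚ.≤-Reasoning
    masked≤indicator : ∀ y → (if G x y then ω x y else 0ℚ) ≤ℚ + (if G x y then 1 else 0) / suc k
    masked≤indicator y with G x y in x~y
    ... | true  = ℚ.≤-trans (weight≤wdegY x~y) (wdegY≤1/|Y| y)
    ... | false = ℚ.≤-reflexive (sym (ℚ.0/n≡0 (suc k)))

lemma2p7 : (m k : ℕ) (G : BipGraph m (suc k)) (ω : Weights m (suc k)) (s : Fin m → ℕ)
    → (∀ x y → G x y ≡ true → 0ℚ ≤ℚ ω x y)
    → (∀ x → 1 ≤ s x)
    → ∑ℕ m s ≥ numEdges G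
    → (∀ x → ((+ s x) - (+ 1)) / suc k < wdegX G ω x)
    → (∀ y → wdegY G ω y ≡ (+ 1) / suc k)
    → ∀ x → degX G x ≡ s x
lemma2p7 m k G ω s ω-nonNeg s≥1 ∑s≥|E| wdegX> wdegY≡ = ∑ℕ≤∑ℕ⇒pointwise≡ m s≤degX ∑s≥|E|
  where
  s≤degX : ∀ x → s x ≤ degX G x
  -- once s x = suc t, the numerator (+ s x) - (+ 1) computes to + t
  s≤degX x with s x | s≥1 x | wdegX> x
  ... | suc t | s≤s _ | t/|Y|<wdegX = ℤ.drop‿+<+ (/-cancelʳ-< k (ℚ.<-≤-trans t/|Y|<wdegX
    (wdegX≤degX/|Y| G ω ω-nonNeg (λ y → ℚ.≤-reflexive (wdegY≡ y)) x)))
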